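{- Let $(C,\phi)$ be a multistate monotone system and $k\in\{1,\ldots,M\}$. For $\bm{y}\in\mathfrak{C}\setminus\{\bm{0}\}$ let $A(\bm{y})=\{i:y_i>0\}$, and for $B\subseteq A(\bm{y})$ define $\bm{x}(B)\in\mathfrak{C}$ by $x_i(B)=y_i$ for $i\in B$, $x_i(B)=y_i-1$ for $i\in A(\bm{y})\setminus B$, and $x_i(B)=0$ otherwise. Then $$\delta_k(\bm{y})=\sum_{B\subseteq A(\bm{y})}\phi_k(\bm{x}(B))\,(-1)^{|A(\bm{y})|-|B|}.$$
   Context: A multistate monotone system (MMS) $(C,\phi)$ has component set $C=\{1,\ldots,n\}$, component state sets $\mathcal{S}_i=\{0,1,\ldots,m_i\}$, component state space $\mathfrak{C}=\mathcal{S}_1\times\cdots\times\mathcal{S}_n$, system state set $\{0,1,\ldots,M\}$, and a structure function $\phi:\mathfrak{C}\to\{0,\ldots,M\}$ non-decreasing in each argument; $\phi_k(\bm{x})=\mathrm{I}(\phi(\bm{x})\ge k)$. Vectors are ordered componentwise. A minimal $k$-level path vector is $\bm{x}\in\mathfrak{C}$ with $\phi(\bm{x})\ge k$ and $\phi(\bm{y})<k$ for all $\bm{y}\le\bm{x}$, $\bm{y}\ne\bm{x}$; $\mathfrak{P}_k$ is the set of these, and $\mathrm{cl}(\mathfrak{P}_k)$ is the smallest set containing $\mathfrak{P}_k$ closed under componentwise maximum $\vee$. A formation of $\bm{x}\in\mathrm{cl}(\mathfrak{P}_k)$ is a nonempty subset $\{\bm{x}_{i_1},\ldots,\bm{x}_{i_j}\}\subseteq\mathfrak{P}_k$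 with $\bm{x}=\bm{x}_{i_1}\vee\cdots\vee\bm{x}_{i_j}$, odd/even according to parity of $j$. The $k$-level signed domination function is $\delta_k(\bm{x})=$ (number of odd formations) $-$ (number of even formations) for $\bm{x}\in\mathrm{cl}(\mathfrak{P}_k)$, and $\delta_k(\bm{x})=0$ for $\bm{x}\in\mathfrak{C}\setminus\mathrm{cl}(\mathfrak{P}_k)$. -}

module Defs where

open import Data.Nat using (ℕ; zero; suc; _≤_; _<_; _∸_; _⊔_; _≤?_; _<?_)
open import Data.Integer as ℤ using (ℤ)
open import Data.Fin using (Fin)
import Data.Fin as Fin
open import Data.Vec using (Vec; lookup; zipWith; replicate; tabulate)
open import Data.Vec.Properties using (≡-dec)
import Data.Nat as ℕ
open import Data.List using (List; []; _∷_; _++_; map; foldr; length; filter; allFin)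
open import Data.List.Membership.Propositional using (_∈_)
import Data.List.Membership.DecPropositional as DecMem
open import Data.List.Relation.Unary.Unique.Propositional using (Unique)
open import Data.Product using (_×_; Σ)
open import Relation.Nullary using (¬_; Dec; yes; no)
open import Relation.Binary.PropositionalEquality using (_≡_)
open import Function.Bundles using (_⇔_)

-- Multistate monotone systems.  State vectors are  Vec ℕ n ; the
-- component state space  𝔆 = S₁ × ⋯ × Sₙ  is  { x | ∀ i, x i ≤ m i }.

_≤ᵥ_ : ∀ {n} → Vec ℕ n → Vec ℕ n → Set
x ≤ᵥ y = ∀ i → lookup x i ≤ lookup y i

record MMS : Set where
  field
    n    : ℕ
    m    : Fin n → ℕ                      -- S_i = {0,…,m i}
    M    : ℕ                              -- system states {0,…,M}
    φ    : Vec ℕ n → ℕ                    -- structure function (meaningful on 𝔆)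
    φ-range : ∀ x → x ≤ᵥ tabulate m → φ x ≤ M
    φ-mono  : ∀ x y → x ≤ᵥ tabulate m → y ≤ᵥ tabulate m → x ≤ᵥ y → φ x ≤ φ y

  InStateSpace : Vec ℕ n → Set
  InStateSpace x = x ≤ᵥ tabulate m

  φ[_] : ℕ → Vec ℕ n → ℤ
  φ[ k ] x with k ≤? φ x
  ... | yes _ = ℤ.+ 1
  ... | no  _ = ℤ.+ 0

  IsMinPath : ℕ → Vec ℕ n → Set
  IsMinPath k x = InStateSpace x × k ≤ φ x × (∀ y → y ≤ᵥ x → ¬ (y ≡ x) → φ y < k)

-- all sublists (= all subsets when the list has no duplicates)
sublists : ∀ {A : Set} → List A → List (List A)
sublists [] = [] ∷ []
sublists (x ∷ xs) = sublists xs ++ map (x ∷_) (sublists xs)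

sumℤ : List ℤ → ℤ
sumℤ = foldr ℤ._+_ (ℤ.+ 0)

negOnePow : ℕ → ℤ
negOnePow zero = ℤ.+ 1
negOnePow (suc j) = ℤ.- negOnePow j

join : ∀ {n} → List (Vec ℕ n) → Vec ℕ n
join {n} = foldr (zipWith _⊔_) (replicate n 0)

-- Signed domination function δ_k, computed from a duplicate-free list Ps
-- enumerating 𝔓_k: a formation of x is a nonempty subset S ⊆ 𝔓_k with
-- join S = x, contributing +1 if |S| odd and -1 if |S| even, i.e.
-- (-1)^(|S|+1).  If x ∉ cl(𝔓_k) there are no formations, so the sum is 0.
δ-from : ∀ {n} → List (Vec ℕ n) → Vec ℕ n → ℤ
δ-from {n} Ps x = sumℤ (map contrib (sublists Ps))
  where
  contrib : List (Vec ℕ n) → ℤ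
  contrib [] = ℤ.+ 0
  contrib S@(_ ∷ _) with ≡-dec ℕ._≟_ (join S) x
  ... | yes _ = negOnePow (suc (length S))
  ... | no  _ = ℤ.+ 0

A : ∀ {n} → Vec ℕ n → List (Fin n)
A {n} y = filter (λ i → 0 <? lookup y i) (allFin n)

xB : ∀ {n} → Vec ℕ n → List (Fin n) → Vec ℕ n
xB {n} y B = tabulate f
  where
  open DecMem (Fin._≟_ {n}) using () renaming (_∈?_ to _∈Fin?_)
  f : Fin n → ℕ
  f i with i ∈Fin? B
  ... | yes _ = lookup y i
  ... | no _ with i ∈Fin? A y
  ... | yes _ = lookup y i ∸ 1
  ... | no _ = 0

-- Both sides are expanded in the indicators [w ≤ z].  First, φ_k(z) = 1 exactly
-- when z dominates a minimal k-level path vector (lower z one unit at a time for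
-- as long as the level stays ≥ k), so inclusion–exclusion over the minimal path
-- vectors gives  φ_k(z) = Σ_{∅ ≠ S ⊆ 𝔓_k} (-1)^(|S|+1) [∨S ≤ z].  Putting z = x(B)
-- and exchanging the two sums leaves, for w = ∨S, the Möbius function of the box
-- below y:  Σ_{B ⊆ A(y)} (-1)^(|A(y)|-|B|) [w ≤ x(B)] = [w = y],  because for
-- w ≤ y the x(B) above w are exactly those with B ⊇ {i ∈ A(y) | w_i = y_i}, and
-- an alternating sum over all supersets of T ⊆ A(y) vanishes unless T = A(y).
-- What remains, Σ_S (-1)^(|S|+1) [∨S = y], is δ_k(y) by definition.
module Submission where

open import Defs
open import Data.Nat using (ℕ; _≤_)
open import Data.Integer as ℤ using (ℤ)
open import Data.Vec using (Vec; lookup)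
open import Data.List using (List; map; length)
open import Data.List.Membership.Propositional using (_∈_)
open import Data.List.Relation.Unary.Unique.Propositional using (Unique)
open import Data.Product using (_×_)
open import Relation.Nullary using (¬_)
open import Relation.Binary.PropositionalEquality using (_≡_)
open import Function.Bundles using (_⇔_)
open import Data.Nat using (_∸_)

open import Data.Bool using (if_then_else_)
open import Data.Nat as ℕ using (suc; pred; _<_; _⊔_; z≤n)
import Data.Nat.Properties as ℕₚ
open import Data.Nat.Induction using (<-wellFounded)
open import Induction.WellFounded using (Acc; acc)
open import Data.Integer using (_+_; _*_; -_; _-_; 0ℤ; 1ℤ)
import Data.Integer.Properties as ℤₚ
open import Data.Integer.Tactic.RingSolver using (solve-∀)
open import Algebra.Properties.CommutativeSemigroup ℤₚ.+-commutativeSemigroup using () renaming (interchange to +-interchange)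
open import Data.Fin as Fin using (Fin)
import Data.Fin.Properties as Finₚ
open import Data.Vec as Vec using (updateAt; _∷_)
open import Data.Vec.Properties using (lookup∘tabulate; lookup∘updateAt; lookup∘updateAt′; tabulate∘lookup; tabulate-cong; lookup-zipWith; lookup-replicate; ≡-dec)
open import Data.List using ([]; _∷_; _++_; foldr; allFin)
open import Data.List.Properties using (map-∘; map-cong; map-cong-local)
open import Data.List.Membership.Propositional using (_∉_; find; lose)
open import Data.List.Membership.Propositional.Properties using (∈-++⁻; ∈-++⁺ˡ; ∈-++⁺ʳ; ∈-map⁻; ∈-map⁺; ∈-filter⁺; ∈-filter⁻; ∈-allFin)
import Data.List.Membership.DecPropositional as DecMembership
open import Data.List.Relation.Unary.Any as Any using (Any; here; there)
open import Data.List.Relation.Unary.All as All using (All; []; _∷_)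
open import Data.List.Relation.Unary.All.Properties using (All¬⇒¬Any)
open import Data.List.Relation.Unary.AllPairs using (_∷_)
open import Data.List.Relation.Unary.Unique.Propositional.Properties using (filter⁺; allFin⁺)
open import Data.List.Relation.Binary.Sublist.Propositional as Sublist using (_⊆_; []; _∷_; _∷ʳ_)
open import Data.List.Relation.Binary.Sublist.Heterogeneous.Properties using (length-mono-≤)
open import Data.Product using (Σ; ∃-syntax; _,_; proj₁; proj₂)
open import Data.Sum using (inj₁; inj₂)
open import Data.Empty using (⊥-elim)
open import Function using (_∘_; _∋_)
open import Function.Bundles using (mk⇔; Equivalence)
open import Relation.Nullary using (Dec; yes; no; does; _×-dec_)
open import Relation.Nullary.Decidable using (decidable-stable)
open import Relation.Unary using (Decidable)
open import Relation.Binary.PropositionalEquality using (refl; sym; trans; cong; cong₂; subst; _≢_; module ≡-Reasoning)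

open Equivalence using (to; from)

private variable
  X Y : Set

𝟙 : ∀ {P : Set} → Dec P → ℤ
𝟙 d = if does d then 1ℤ else 0ℤ

𝟙-yes : ∀ {P : Set} → P → (d : Dec P) → 𝟙 d ≡ 1ℤ
𝟙-yes _ (yes _) = refl
𝟙-yes p (no ¬p) = ⊥-elim (¬p p)

𝟙-no : ∀ {P : Set} → ¬ P → (d : Dec P) → 𝟙 d ≡ 0ℤ
𝟙-no ¬p (yes p) = ⊥-elim (¬p p)
𝟙-no _ (no _) = refl

𝟙-⇔ : ∀ {P Q : Set} → P ⇔ Q → (d : Dec P) (e : Dec Q) → 𝟙 d ≡ 𝟙 e
𝟙-⇔ P⇔Q (yes p) e = sym (𝟙-yes (to P⇔Q p) e)
𝟙-⇔ P⇔Q (no ¬p) e = sym (𝟙-no (¬p ∘ from P⇔Q) e)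

sumOver : (X → ℤ) → List X → ℤ
sumOver f xs = sumℤ (map f xs)

prodOver : (X → ℤ) → List X → ℤ
prodOver f xs = foldr _*_ 1ℤ (map f xs)

infix 5 sumOver prodOver
syntax sumOver (λ x → e) xs = ∑[ x ← xs ] e
syntax prodOver (λ x → e) xs = ∏[ x ← xs ] e

sum-++ : ∀ (f : X → ℤ) xs ys → sumOver f (xs ++ ys) ≡ sumOver f xs + sumOver f ys
sum-++ f [] ys = sym (ℤₚ.+-identityˡ _)
sum-++ f (x ∷ xs) ys = trans (cong (f x +_) (sum-++ f xs ys)) (sym (ℤₚ.+-assoc (f x) _ _))

sum-map : ∀ (f : X → ℤ) (g : Y → X) ys → sumOver f (map g ys) ≡ sumOver (f ∘ g) ys
sum-map f g ys = cong sumℤ (sym (map-∘ ys))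

sum-cong : ∀ {f g : X → ℤ} → (∀ x → f x ≡ g x) → ∀ xs → sumOver f xs ≡ sumOver g xs
sum-cong f≗g xs = cong sumℤ (map-cong f≗g xs)

sum-cong-∈ : ∀ {f g : X → ℤ} xs → (∀ {x} → x ∈ xs → f x ≡ g x) → sumOver f xs ≡ sumOver g xs
sum-cong-∈ xs f≗g = cong sumℤ (map-cong-local (All.tabulate f≗g))

sum-zero : ∀ {f : X → ℤ} xs → (∀ {x} → x ∈ xs → f x ≡ 0ℤ) → sumOver f xs ≡ 0ℤ
sum-zero [] _ = refl
sum-zero (x ∷ xs) f≡0 = cong₂ _+_ (f≡0 (here refl)) (sum-zero xs (f≡0 ∘ there))

sum-+ : ∀ (f g : X → ℤ) xs → (∑[ x ← xs ] f x + g x) ≡ sumOver f xs + sumOver g xs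
sum-+ f g [] = refl
sum-+ f g (x ∷ xs) = trans (cong (f x + g x +_) (sum-+ f g xs)) (+-interchange (f x) (g x) _ _)

sum-neg : ∀ (f : X → ℤ) xs → (∑[ x ← xs ] - f x) ≡ - sumOver f xs
sum-neg f [] = refl
sum-neg f (x ∷ xs) = trans (cong (- f x +_) (sum-neg f xs)) (sym (ℤₚ.neg-distrib-+ (f x) _))

sum-*ˡ : ∀ c (f : X → ℤ) xs → c * sumOver f xs ≡ (∑[ x ← xs ] c * f x)
sum-*ˡ c f [] = ℤₚ.*-zeroʳ c
sum-*ˡ c f (x ∷ xs) = trans (ℤₚ.*-distribˡ-+ c (f x) _) (cong (c * f x +_) (sum-*ˡ c f xs))

sum-*ʳ : ∀ c (f : X → ℤ) xs → sumOver f xs * c ≡ (∑[ x ← xs ] f x * c)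
sum-*ʳ c f xs = trans (ℤₚ.*-comm _ c) (trans (sum-*ˡ c f xs) (sum-cong (λ x → ℤₚ.*-comm c (f x)) xs))

sum-swap : ∀ (F : X → Y → ℤ) xs ys →
           (∑[ x ← xs ] ∑[ y ← ys ] F x y) ≡ (∑[ y ← ys ] ∑[ x ← xs ] F x y)
sum-swap F [] ys = sym (sum-zero ys (λ _ → refl))
sum-swap F (x ∷ xs) ys = trans (cong (sumOver (F x) ys +_) (sum-swap F xs ys)) (sym (sum-+ _ _ ys))

sum-exchange : ∀ (a : Y → ℤ) (b : X → Y → ℤ) (c : X → ℤ) xs ys →
               (∑[ x ← xs ] (∑[ y ← ys ] a y * b x y) * c x)
                 ≡ (∑[ y ← ys ] a y * (∑[ x ← xs ] b x y * c x))
sum-exchange a b c xs ys = begin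
    (∑[ x ← xs ] (∑[ y ← ys ] a y * b x y) * c x)
  ≡⟨ sum-cong (λ x → sum-*ʳ (c x) _ ys) xs ⟩
    (∑[ x ← xs ] ∑[ y ← ys ] a y * b x y * c x)
  ≡⟨ sum-swap _ xs ys ⟩
    (∑[ y ← ys ] ∑[ x ← xs ] a y * b x y * c x)
  ≡⟨ sum-cong (λ y → trans (sum-cong (λ x → ℤₚ.*-assoc (a y) _ _) xs) (sym (sum-*ˡ (a y) _ xs))) ys ⟩
    (∑[ y ← ys ] a y * (∑[ x ← xs ] b x y * c x))
  ∎
  where open ≡-Reasoning

prod-𝟙 : ∀ {P : X → Set} (P? : Decidable P) xs → (∏[ x ← xs ] 𝟙 (P? x)) ≡ 𝟙 (All.all? P? xs)
prod-𝟙 P? [] = refl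
prod-𝟙 P? (x ∷ xs) rewrite prod-𝟙 P? xs with P? x | All.all? P? xs
... | yes _ | yes _ = refl
... | yes _ | no _ = refl
... | no _ | yes _ = refl
... | no _ | no _ = refl

𝟙-any : ∀ {P : X → Set} (P? : Decidable P) xs → 𝟙 (Any.any? P? xs) ≡ 1ℤ - (∏[ x ← xs ] 1ℤ - 𝟙 (P? x))
𝟙-any P? [] = refl
𝟙-any P? (x ∷ xs) with P? x
... | yes _ = sym (cong (λ p → 1ℤ - p) (ℤₚ.*-zeroˡ (∏[ x ← xs ] 1ℤ - 𝟙 (P? x))))
... | no _ = trans (𝟙-any P? xs) (cong (λ p → 1ℤ - p) (sym (ℤₚ.*-identityˡ (∏[ x ← xs ] 1ℤ - 𝟙 (P? x)))))

sublists-⊆ : ∀ {L B : List X} → B ∈ sublists L → B ⊆ L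
sublists-⊆ {L = []} (here refl) = []
sublists-⊆ {L = x ∷ L} B∈ with ∈-++⁻ (sublists L) B∈
... | inj₁ B∈L = x ∷ʳ sublists-⊆ B∈L
... | inj₂ B∈xL with ∈-map⁻ (x ∷_) B∈xL
... | _ , B′∈L , refl = refl ∷ sublists-⊆ B′∈L

sum-sublists-∷ : ∀ (f : List X → ℤ) x L →
                 (∑[ B ← sublists (x ∷ L) ] f B) ≡ (∑[ B ← sublists L ] f B) + (∑[ B ← sublists L ] f (x ∷ B))
sum-sublists-∷ f x L =
  trans (sum-++ f (sublists L) _) (cong (sumOver f (sublists L) +_) (sum-map f (x ∷_) (sublists L)))

sign : List X → List X → ℤ
sign L B = negOnePow (length L ∸ length B)

sign-∷ : ∀ x {L B : List X} → B ⊆ L → sign (x ∷ L) B ≡ - sign L B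
sign-∷ x B⊆L = cong negOnePow (ℕₚ.+-∸-assoc 1 (length-mono-≤ B⊆L))

signed-sum-sublists-∷ : ∀ (f : List X → ℤ) x L →
  (∑[ B ← sublists (x ∷ L) ] f B * sign (x ∷ L) B)
    ≡ - (∑[ B ← sublists L ] f B * sign L B) + (∑[ B ← sublists L ] f (x ∷ B) * sign L B)
signed-sum-sublists-∷ f x L = begin
    (∑[ B ← sublists (x ∷ L) ] f B * sign (x ∷ L) B)
  ≡⟨ sum-sublists-∷ (λ B → f B * sign (x ∷ L) B) x L ⟩
    (∑[ B ← sublists L ] f B * sign (x ∷ L) B) + (∑[ B ← sublists L ] f (x ∷ B) * sign L B)
  ≡⟨ cong (_+ rest) (sum-cong-∈ (sublists L) λ B∈ → flip-sign (sublists-⊆ B∈)) ⟩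
    (∑[ B ← sublists L ] - (f B * sign L B)) + (∑[ B ← sublists L ] f (x ∷ B) * sign L B)
  ≡⟨ cong (_+ rest) (sum-neg _ (sublists L)) ⟩
    - (∑[ B ← sublists L ] f B * sign L B) + (∑[ B ← sublists L ] f (x ∷ B) * sign L B)
  ∎
  where
  open ≡-Reasoning
  rest : ℤ
  rest = ∑[ B ← sublists L ] f (x ∷ B) * sign L B
  flip-sign : ∀ {B} → B ⊆ L → f B * sign (x ∷ L) B ≡ - (f B * sign L B)
  flip-sign {B} B⊆L = trans (cong (f B *_) (sign-∷ x B⊆L)) (sym (ℤₚ.neg-distribʳ-* (f B) _))

module _ {P : X → Set} (P? : Decidable P) where

  -- With T = {i ∈ L | P i} this is  Σ_{T ⊆ B ⊆ L} (-1)^|L∖B| = [T = L].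
  alternating-sum-supersets : ∀ {L} → Unique L → {Q : List X → Set} (Q? : Decidable Q) →
    (∀ {B} → B ∈ sublists L → Q B ⇔ All (λ i → P i → i ∈ B) L) →
    (∑[ B ← sublists L ] 𝟙 (Q? B) * sign L B) ≡ 𝟙 (All.all? P? L)
  alternating-sum-supersets {[]} _ Q? Q⇔ rewrite 𝟙-yes (from (Q⇔ (here refl)) []) (Q? []) = refl
  alternating-sum-supersets {x ∷ L} (x≢L ∷ L!) {Q} Q? Q⇔ =
    trans (signed-sum-sublists-∷ (𝟙 ∘ Q?) x L) cases
    where
    x∉L : x ∉ L
    x∉L = All¬⇒¬Any x≢L

    drop-x : ∀ {i B} → i ∈ L → i ∈ x ∷ B → i ∈ B
    drop-x i∈L (here refl) = ⊥-elim (x∉L i∈L)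
    drop-x _ (there i∈B) = i∈B

    Q-without-x : ¬ P x → ∀ {B} → B ∈ sublists L → Q B ⇔ All (λ i → P i → i ∈ B) L
    Q-without-x ¬Px B∈ = mk⇔ (All.tail ∘ to (Q⇔ (∈-++⁺ˡ B∈)))
                             (from (Q⇔ (∈-++⁺ˡ B∈)) ∘ ((⊥-elim ∘ ¬Px) ∷_))

    Q-with-x : ∀ {B} → B ∈ sublists L → Q (x ∷ B) ⇔ All (λ i → P i → i ∈ B) L
    Q-with-x B∈ = mk⇔ (λ q → All.tabulate λ i∈L Pi →
                               drop-x i∈L (All.lookup (All.tail (to (Q⇔ xB∈) q)) i∈L Pi))
                      (λ all → from (Q⇔ xB∈) ((λ _ → here refl) ∷ All.map (there ∘_) all))
      where xB∈ = ∈-++⁺ʳ (sublists L) (∈-map⁺ (x ∷_) B∈)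

    with-x : (∑[ B ← sublists L ] 𝟙 (Q? (x ∷ B)) * sign L B) ≡ 𝟙 (All.all? P? L)
    with-x = alternating-sum-supersets L! (Q? ∘ (x ∷_)) Q-with-x

    cases : - (∑[ B ← sublists L ] 𝟙 (Q? B) * sign L B) + (∑[ B ← sublists L ] 𝟙 (Q? (x ∷ B)) * sign L B)
              ≡ 𝟙 (All.all? P? (x ∷ L))
    cases with P? x
    ... | yes Px = trans (cong₂ (λ a b → - a + b) without-x with-x) (ℤₚ.+-identityˡ _)
      where
      ¬Q : ∀ {B} → B ∈ sublists L → ¬ Q B
      ¬Q B∈ q = x∉L (Sublist.lookup (sublists-⊆ B∈) (All.head (to (Q⇔ (∈-++⁺ˡ B∈)) q) Px))
      without-x : (∑[ B ← sublists L ] 𝟙 (Q? B) * sign L B) ≡ 0ℤ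
      without-x = sum-zero (sublists L) λ {B} B∈ → cong (_* sign L B) (𝟙-no (¬Q B∈) (Q? B))
    ... | no ¬Px = trans (cong₂ (λ a b → - a + b) without-x with-x) (ℤₚ.+-inverseˡ (𝟙 (All.all? P? L)))
      where
      without-x : (∑[ B ← sublists L ] 𝟙 (Q? B) * sign L B) ≡ 𝟙 (All.all? P? L)
      without-x = alternating-sum-supersets L! Q? (Q-without-x ¬Px)

formationSign : List X → ℤ
formationSign [] = 0ℤ
formationSign S@(_ ∷ _) = negOnePow (suc (length S))

module _ (t : X → ℤ) where

  sum-sublists-signed-product : ∀ L →
    (∑[ S ← sublists L ] negOnePow (length S) * (∏[ x ← S ] t x)) ≡ (∏[ x ← L ] 1ℤ - t x)
  sum-sublists-signed-product [] = refl
  sum-sublists-signed-product (x ∷ L) = begin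
      (∑[ S ← sublists (x ∷ L) ] f S)
    ≡⟨ sum-sublists-∷ f x L ⟩
      sumOver f (sublists L) + (∑[ S ← sublists L ] f (x ∷ S))
    ≡⟨ cong (sumOver f (sublists L) +_) (sum-cong with-x (sublists L)) ⟩
      sumOver f (sublists L) + (∑[ S ← sublists L ] - (t x * f S))
    ≡⟨ cong (sumOver f (sublists L) +_) (trans (sum-neg _ (sublists L)) (cong -_ (sym (sum-*ˡ (t x) f (sublists L))))) ⟩
      sumOver f (sublists L) - t x * sumOver f (sublists L)
    ≡⟨ cong (λ p → p - t x * p) (sum-sublists-signed-product L) ⟩
      p - t x * p
    ≡⟨ factor-out (t x) p ⟩
      (1ℤ - t x) * p
    ∎
    where
    open ≡-Reasoning
    f : List X → ℤ
    f S = negOnePow (length S) * (∏[ x ← S ] t x)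
    p : ℤ
    p = ∏[ x ← L ] 1ℤ - t x
    move-factor : ∀ s a q → - s * (a * q) ≡ - (a * (s * q))
    move-factor = solve-∀
    with-x : ∀ S → f (x ∷ S) ≡ - (t x * f S)
    with-x S = move-factor (negOnePow (length S)) (t x) (∏[ x ← S ] t x)
    factor-out : ∀ a q → q - a * q ≡ (1ℤ - a) * q
    factor-out = solve-∀

  inclusion–exclusion : ∀ L →
    (∑[ S ← sublists L ] formationSign S * (∏[ x ← S ] t x)) ≡ 1ℤ - (∏[ x ← L ] 1ℤ - t x)
  inclusion–exclusion [] = refl
  inclusion–exclusion (x ∷ L) = begin
      (∑[ S ← sublists (x ∷ L) ] g S)
    ≡⟨ sum-sublists-∷ g x L ⟩
      sumOver g (sublists L) + (∑[ S ← sublists L ] g (x ∷ S))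
    ≡⟨ cong (sumOver g (sublists L) +_) (sum-cong with-x (sublists L)) ⟩
      sumOver g (sublists L) + (∑[ S ← sublists L ] t x * f S)
    ≡⟨ cong₂ _+_ (inclusion–exclusion L)
                 (trans (sym (sum-*ˡ (t x) f (sublists L))) (cong (t x *_) (sum-sublists-signed-product L))) ⟩
      1ℤ - p + t x * p
    ≡⟨ factor-out (t x) p ⟩
      1ℤ - (1ℤ - t x) * p
    ∎
    where
    open ≡-Reasoning
    f g : List X → ℤ
    f S = negOnePow (length S) * (∏[ x ← S ] t x)
    g S = formationSign S * (∏[ x ← S ] t x)
    p : ℤ
    p = ∏[ x ← L ] 1ℤ - t x
    move-factor : ∀ s a q → - - s * (a * q) ≡ a * (s * q)
    move-factor = solve-∀
    with-x : ∀ S → g (x ∷ S) ≡ t x * f S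
    with-x S = move-factor (negOnePow (length S)) (t x) (∏[ x ← S ] t x)
    factor-out : ∀ a q → 1ℤ - q + a * q ≡ 1ℤ - (1ℤ - a) * q
    factor-out = solve-∀

module _ {n : ℕ} where

  _≤ᵥ?_ : (x y : Vec ℕ n) → Dec (x ≤ᵥ y)
  x ≤ᵥ? y = Finₚ.all? λ i → lookup x i ℕ.≤? lookup y i

  _≡ᵥ?_ : (x y : Vec ℕ n) → Dec (x ≡ y)
  _≡ᵥ?_ = ≡-dec ℕ._≟_

  ≡-from-lookup : ∀ {x y : Vec ℕ n} → (∀ i → lookup x i ≡ lookup y i) → x ≡ y
  ≡-from-lookup {x} {y} eq = trans (sym (tabulate∘lookup x)) (trans (tabulate-cong eq) (tabulate∘lookup y))

  join-≤ : ∀ {S : List (Vec ℕ n)} {z} → join S ≤ᵥ z ⇔ All (_≤ᵥ z) S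
  join-≤ {[]} {z} = mk⇔ (λ _ → []) (λ _ i → subst (_≤ lookup z i) (sym (lookup-replicate i 0)) z≤n)
  join-≤ {p ∷ S} {z} = mk⇔ split merge
    where
    lookup-join : ∀ i → lookup (join (p ∷ S)) i ≡ lookup p i ⊔ lookup (join S) i
    lookup-join i = lookup-zipWith _⊔_ i p (join S)

    split : join (p ∷ S) ≤ᵥ z → All (_≤ᵥ z) (p ∷ S)
    split ∨≤z = (λ i → ℕₚ.≤-trans (ℕₚ.m≤m⊔n _ _) (at i))
              ∷ to (join-≤ {S} {z}) (λ i → ℕₚ.≤-trans (ℕₚ.m≤n⊔m _ _) (at i))
      where
      at : ∀ i → lookup p i ⊔ lookup (join S) i ≤ lookup z i
      at i = subst (_≤ lookup z i) (lookup-join i) (∨≤z i)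

    merge : All (_≤ᵥ z) (p ∷ S) → join (p ∷ S) ≤ᵥ z
    merge (p≤z ∷ S≤z) i =
      subst (_≤ lookup z i) (sym (lookup-join i)) (ℕₚ.⊔-lub (p≤z i) (from (join-≤ {S} {z}) S≤z i))

  prod-𝟙-≤ : ∀ (S : List (Vec ℕ n)) z → (∏[ p ← S ] 𝟙 (p ≤ᵥ? z)) ≡ 𝟙 (join S ≤ᵥ? z)
  prod-𝟙-≤ S z =
    trans (prod-𝟙 (_≤ᵥ? z) S) (sym (𝟙-⇔ (join-≤ {S} {z}) (join S ≤ᵥ? z) (All.all? (_≤ᵥ? z) S)))

  decrementAt : Vec ℕ n → Fin n → Vec ℕ n
  decrementAt z i = updateAt z i pred

  decrementAt-≤ : ∀ z i → decrementAt z i ≤ᵥ z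
  decrementAt-≤ z i j with j Fin.≟ i
  ... | yes refl = ℕₚ.≤-trans (ℕₚ.≤-reflexive (lookup∘updateAt i z)) ℕₚ.pred[n]≤n
  ... | no j≢i = ℕₚ.≤-reflexive (lookup∘updateAt′ j i j≢i z)

  ≤-decrementAt : ∀ {w z} i → w ≤ᵥ z → lookup w i < lookup z i → w ≤ᵥ decrementAt z i
  ≤-decrementAt {w} {z} i w≤z wᵢ<zᵢ j with j Fin.≟ i
  ... | yes refl = ℕₚ.≤-trans (ℕₚ.<⇒≤pred wᵢ<zᵢ) (ℕₚ.≤-reflexive (sym (lookup∘updateAt i z)))
  ... | no j≢i = ℕₚ.≤-trans (w≤z j) (ℕₚ.≤-reflexive (sym (lookup∘updateAt′ j i j≢i z)))

sum-decrementAt : ∀ {n} (z : Vec ℕ n) i → 0 < lookup z i → Vec.sum (decrementAt z i) < Vec.sum z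
sum-decrementAt (suc x ∷ z) Fin.zero _ = ℕₚ.n<1+n _
sum-decrementAt (x ∷ z) (Fin.suc i) zᵢ>0 = ℕₚ.+-monoʳ-< x (sum-decrementAt z i zᵢ>0)

module _ (S : MMS) where
  open MMS S

  φ[]≡𝟙 : ∀ k x → φ[ k ] x ≡ 𝟙 (k ℕ.≤? φ x)
  φ[]≡𝟙 k x with k ℕ.≤? φ x
  ... | yes k≤φx = sym (𝟙-yes k≤φx (k ℕ.≤? φ x))
  ... | no k≰φx = sym (𝟙-no k≰φx (k ℕ.≤? φ x))

  decrementAt-∈ℭ : ∀ z i → InStateSpace z → InStateSpace (decrementAt z i)
  decrementAt-∈ℭ z i z∈ℭ j = ℕₚ.≤-trans (decrementAt-≤ z i j) (z∈ℭ j)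

  module _ {k : ℕ} where

    minPath-below : ∀ z → Acc _<_ (Vec.sum z) → InStateSpace z → k ≤ φ z → ∃[ p ] IsMinPath k p × p ≤ᵥ z
    minPath-below z (acc smaller) z∈ℭ k≤φz
      with Finₚ.any? (λ i → (0 ℕ.<? lookup z i) ×-dec (k ℕ.≤? φ (decrementAt z i)))
    ... | yes (i , zᵢ>0 , k≤φz′) =
      let p , p-min , p≤z′ = minPath-below (decrementAt z i) (smaller (sum-decrementAt z i zᵢ>0))
                                           (decrementAt-∈ℭ z i z∈ℭ) k≤φz′
      in p , p-min , λ j → ℕₚ.≤-trans (p≤z′ j) (decrementAt-≤ z i j)
    ... | no no-descent = z , (z∈ℭ , k≤φz , below-fails) , λ _ → ℕₚ.≤-refl
      where
      -- Anything strictly below z lies below a one-step decrease of z.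
      below-fails : ∀ y → y ≤ᵥ z → y ≢ z → φ y < k
      below-fails y y≤z y≢z
        with Finₚ.¬∀⟶∃¬ n _ (λ i → lookup y i ℕ.≟ lookup z i) (y≢z ∘ ≡-from-lookup)
      ... | i , yᵢ≢zᵢ = ℕₚ.≤-<-trans φy≤φz′ φz′<k
        where
        yᵢ<zᵢ : lookup y i < lookup z i
        yᵢ<zᵢ = ℕₚ.≤∧≢⇒< (y≤z i) yᵢ≢zᵢ
        φy≤φz′ : φ y ≤ φ (decrementAt z i)
        φy≤φz′ = φ-mono y (decrementAt z i)
                        (λ j → ℕₚ.≤-trans (y≤z j) (z∈ℭ j)) (decrementAt-∈ℭ z i z∈ℭ)
                        (≤-decrementAt {w = y} {z = z} i y≤z yᵢ<zᵢ)
        φz′<k : φ (decrementAt z i) < k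
        φz′<k = ℕₚ.≰⇒> λ k≤φz′ → no-descent (i , ℕₚ.≤-<-trans z≤n yᵢ<zᵢ , k≤φz′)

    module _ (Ps : List (Vec ℕ n)) (Ps⇔ : ∀ x → (x ∈ Ps) ⇔ IsMinPath k x) where

      reaches-level⇔dominates-minPath : ∀ {z} → InStateSpace z → k ≤ φ z ⇔ Any (_≤ᵥ z) Ps
      reaches-level⇔dominates-minPath {z} z∈ℭ = mk⇔
        (λ k≤φz → let p , p-min , p≤z = minPath-below z (<-wellFounded _) z∈ℭ k≤φz
                  in lose (from (Ps⇔ p) p-min) p≤z)
        (λ some≤z → let p , p∈Ps , p≤z = find some≤z
                        p∈ℭ , k≤φp , _ = to (Ps⇔ p) p∈Ps
                    in ℕₚ.≤-trans k≤φp (φ-mono p z p∈ℭ z∈ℭ p≤z))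

      φ-expansion : ∀ {z} → InStateSpace z →
                    φ[ k ] z ≡ (∑[ T ← sublists Ps ] formationSign T * 𝟙 (join T ≤ᵥ? z))
      φ-expansion {z} z∈ℭ = begin
          φ[ k ] z
        ≡⟨ φ[]≡𝟙 k z ⟩
          𝟙 (k ℕ.≤? φ z)
        ≡⟨ 𝟙-⇔ (reaches-level⇔dominates-minPath {z} z∈ℭ) (k ℕ.≤? φ z) (Any.any? (_≤ᵥ? z) Ps) ⟩
          𝟙 (Any.any? (_≤ᵥ? z) Ps)
        ≡⟨ 𝟙-any (_≤ᵥ? z) Ps ⟩
          1ℤ - (∏[ p ← Ps ] 1ℤ - 𝟙 (p ≤ᵥ? z))
        ≡⟨ sym (inclusion–exclusion (λ p → 𝟙 (p ≤ᵥ? z)) Ps) ⟩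
          (∑[ T ← sublists Ps ] formationSign T * (∏[ p ← T ] 𝟙 (p ≤ᵥ? z)))
        ≡⟨ sum-cong (λ T → cong (formationSign T *_) (prod-𝟙-≤ T z)) (sublists Ps) ⟩
          (∑[ T ← sublists Ps ] formationSign T * 𝟙 (join T ≤ᵥ? z))
        ∎
        where open ≡-Reasoning

pred[n]<n : ∀ {m} → 0 < m → pred m < m
pred[n]<n {suc m} _ = ℕₚ.n<1+n m

module _ {n : ℕ} where
  open DecMembership (Fin._≟_ {n}) using (_∈?_)

  ∈-A⁻ : ∀ (y : Vec ℕ n) {i} → i ∈ A y → 0 < lookup y i
  ∈-A⁻ y i∈A = proj₂ (∈-filter⁻ (λ i → 0 ℕ.<? lookup y i) {xs = allFin n} i∈A)

  ∉-A : ∀ (y : Vec ℕ n) {i} → i ∉ A y → lookup y i ≡ 0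
  ∉-A y {i} i∉A = ℕₚ.n≤0⇒n≡0 (ℕₚ.≮⇒≥ (i∉A ∘ ∈-filter⁺ (λ i → 0 ℕ.<? lookup y i) (∈-allFin i)))

  A-unique : ∀ (y : Vec ℕ n) → Unique (A y)
  A-unique y = filter⁺ (λ i → 0 ℕ.<? lookup y i) (allFin⁺ n)

  -- xB tabulates a local function of Defs; the ascription (_ ∋ _) lets unification
  -- name it, so that with can split on the membership tests it performs.
  lookup-xB-∈ : ∀ (y : Vec ℕ n) {B i} → i ∈ B → lookup (xB y B) i ≡ lookup y i
  lookup-xB-∈ y {B} {i} i∈B with i ∈? B | (lookup (xB y B) i ≡ _ ∋ lookup∘tabulate _ i)
  ... | yes _ | eq = eq
  ... | no i∉B | _ = ⊥-elim (i∉B i∈B)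

  -- Off A(y) the paper's x_i(B) = 0 is also y_i ∸ 1 = 0 ∸ 1, so one formula covers every i ∉ B.
  lookup-xB-∉ : ∀ (y : Vec ℕ n) {B i} → i ∉ B → lookup (xB y B) i ≡ pred (lookup y i)
  lookup-xB-∉ y {B} {i} i∉B with i ∈? B | (lookup (xB y B) i ≡ _ ∋ lookup∘tabulate _ i)
  ... | yes i∈B | _ = ⊥-elim (i∉B i∈B)
  ... | no _ | eq with i ∈? A y | eq
  ...   | yes _ | eq′ = eq′
  ...   | no i∉A | eq′ = trans eq′ (cong pred (sym (∉-A y i∉A)))

  xB-≤ : ∀ (y : Vec ℕ n) B → xB y B ≤ᵥ y
  xB-≤ y B i with i ∈? B
  ... | yes i∈B = ℕₚ.≤-reflexive (lookup-xB-∈ y i∈B)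
  ... | no i∉B = ℕₚ.≤-trans (ℕₚ.≤-reflexive (lookup-xB-∉ y i∉B)) ℕₚ.pred[n]≤n

  ≤-xB⇔ : ∀ (w y : Vec ℕ n) B → w ≤ᵥ y →
          w ≤ᵥ xB y B ⇔ All (λ i → lookup w i ≡ lookup y i → i ∈ B) (A y)
  ≤-xB⇔ w y B w≤y = mk⇔ forward backward
    where
    forward : w ≤ᵥ xB y B → All (λ i → lookup w i ≡ lookup y i → i ∈ B) (A y)
    forward w≤x = All.tabulate λ {i} i∈A wᵢ≡yᵢ → decidable-stable (i ∈? B) λ i∉B →
      ℕₚ.<⇒≱ (pred[n]<n (∈-A⁻ y i∈A))
             (subst (_≤ pred (lookup y i)) wᵢ≡yᵢ (subst (lookup w i ≤_) (lookup-xB-∉ y i∉B) (w≤x i)))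

    below-pred : ∀ {i} → All (λ i → lookup w i ≡ lookup y i → i ∈ B) (A y) → i ∉ B →
                 lookup w i ≤ pred (lookup y i)
    below-pred {i} tight⊆B i∉B with i ∈? A y
    ... | yes i∈A = ℕₚ.<⇒≤pred (ℕₚ.≤∧≢⇒< (w≤y i) (i∉B ∘ All.lookup tight⊆B i∈A))
    ... | no i∉A = subst (λ v → lookup w i ≤ pred v) (sym (∉-A y i∉A))
                         (subst (lookup w i ≤_) (∉-A y i∉A) (w≤y i))

    backward : All (λ i → lookup w i ≡ lookup y i → i ∈ B) (A y) → w ≤ᵥ xB y B
    backward tight⊆B i with i ∈? B
    ... | yes i∈B = subst (lookup w i ≤_) (sym (lookup-xB-∈ y i∈B)) (w≤y i)
    ... | no i∉B = subst (lookup w i ≤_) (sym (lookup-xB-∉ y i∉B)) (below-pred tight⊆B i∉B)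

  ≡⇔agrees-on-A : ∀ (w y : Vec ℕ n) → w ≤ᵥ y → w ≡ y ⇔ All (λ i → lookup w i ≡ lookup y i) (A y)
  ≡⇔agrees-on-A w y w≤y = mk⇔ (λ { refl → All.tabulate λ _ → refl }) λ tight → ≡-from-lookup (agree tight)
    where
    agree : All (λ i → lookup w i ≡ lookup y i) (A y) → ∀ i → lookup w i ≡ lookup y i
    agree tight i with i ∈? A y
    ... | yes i∈A = All.lookup tight i∈A
    ... | no i∉A = trans (ℕₚ.n≤0⇒n≡0 (subst (lookup w i ≤_) (∉-A y i∉A) (w≤y i))) (sym (∉-A y i∉A))

  alternating-sum-box : ∀ (y w : Vec ℕ n) →
    (∑[ B ← sublists (A y) ] 𝟙 (w ≤ᵥ? xB y B) * sign (A y) B) ≡ 𝟙 (w ≡ᵥ? y)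
  alternating-sum-box y w with w ≤ᵥ? y
  ... | yes w≤y =
    trans (alternating-sum-supersets tight? (A-unique y) (λ B → w ≤ᵥ? xB y B) (λ {B} _ → ≤-xB⇔ w y B w≤y))
          (sym (𝟙-⇔ (≡⇔agrees-on-A w y w≤y) (w ≡ᵥ? y) (All.all? tight? (A y))))
    where
    tight? : ∀ i → Dec (lookup w i ≡ lookup y i)
    tight? i = lookup w i ℕ.≟ lookup y i
  ... | no w≰y =
    trans (sum-zero (sublists (A y)) λ {B} _ →
             cong (_* sign (A y) B) (𝟙-no (w≰y ∘ ≤-via-xB B) (w ≤ᵥ? xB y B)))
          (sym (𝟙-no (λ { refl → w≰y λ _ → ℕₚ.≤-refl }) (w ≡ᵥ? y)))
    where
    ≤-via-xB : ∀ B → w ≤ᵥ xB y B → w ≤ᵥ y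
    ≤-via-xB B w≤x i = ℕₚ.≤-trans (w≤x i) (xB-≤ y B i)

-- δ-from sums a function local to its where-block; projecting the ascribed pair
-- below names that function by unification.
δ-from-expansion : ∀ {n} (Ps : List (Vec ℕ n)) y →
  δ-from Ps y ≡ (∑[ T ← sublists Ps ] formationSign T * 𝟙 (join T ≡ᵥ? y))
δ-from-expansion {n} Ps y = sum-cong contribution≗ (sublists Ps)
  where
  contribution : List (Vec ℕ n) → ℤ
  contribution = proj₁ (Σ (List (Vec ℕ n) → ℤ) (λ c → δ-from Ps y ≡ sumOver c (sublists Ps)) ∋ (_ , refl))

  contribution≗ : ∀ T → contribution T ≡ formationSign T * 𝟙 (join T ≡ᵥ? y)
  contribution≗ [] = refl
  contribution≗ (p ∷ T) with join (p ∷ T) ≡ᵥ? y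
  ... | yes _ = sym (ℤₚ.*-identityʳ (formationSign (p ∷ T)))
  ... | no _ = sym (ℤₚ.*-zeroʳ (formationSign (p ∷ T)))

theorem4p2 : (S : MMS) → let open MMS S in
    (k : ℕ) → 1 ≤ k → k ≤ M →
    (Ps : List (Vec ℕ n)) → Unique Ps → (∀ x → (x ∈ Ps) ⇔ IsMinPath k x) →
    (y : Vec ℕ n) → InStateSpace y → ¬ (∀ i → lookup y i ≡ 0) →
    δ-from Ps y ≡ sumℤ (map (λ B → φ[ k ] (xB y B) ℤ.* negOnePow (length (A y) ∸ length B)) (sublists (A y)))
theorem4p2 S k _ _ Ps _ Ps⇔ y y∈ℭ _ = sym (begin
    (∑[ B ← sublists (A y) ] φ[ k ] (xB y B) * sign (A y) B)
  ≡⟨ sum-cong (λ B → cong (_* sign (A y) B) (φ-expansion S Ps Ps⇔ (xB∈ℭ B))) (sublists (A y)) ⟩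
    (∑[ B ← sublists (A y) ] (∑[ T ← sublists Ps ] formationSign T * 𝟙 (join T ≤ᵥ? xB y B)) * sign (A y) B)
  ≡⟨ sum-exchange formationSign (λ B T → 𝟙 (join T ≤ᵥ? xB y B)) (sign (A y)) (sublists (A y)) (sublists Ps) ⟩
    (∑[ T ← sublists Ps ] formationSign T * (∑[ B ← sublists (A y) ] 𝟙 (join T ≤ᵥ? xB y B) * sign (A y) B))
  ≡⟨ sum-cong (λ T → cong (formationSign T *_) (alternating-sum-box y (join T))) (sublists Ps) ⟩
    (∑[ T ← sublists Ps ] formationSign T * 𝟙 (join T ≡ᵥ? y))
  ≡⟨ sym (δ-from-expansion Ps y) ⟩
    δ-from Ps y
  ∎)
  where
  open ≡-Reasoning
  open MMS S
  xB∈ℭ : ∀ B → InStateSpace (xB y B)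
  xB∈ℭ B i = ℕₚ.≤-trans (xB-≤ y B i) (y∈ℭ i)
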